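{- Let $G$ be a finite abelian group of order $n$ such that the generalized dihedral group $D(G)$ is non-abelian, let $r\ge0$ satisfy $2^r=|\{g\in G:g^2=e\}|$, and let $\Gamma=\mathfrak{C}(D(G),D(G))$. Then the metric dimension of $\Gamma$ is \[\beta(\Gamma)=\begin{cases}2n-\frac{n}{2^r}-2 & \text{if } 2^r\ge 2,\\ 2n-3 & \text{if } 2^r=1.\end{cases}\]
   Context: $D(G)=G\rtimes C_2$, $C_2=\{1,-1\}$, has elements $(g,c)$ with multiplication $(g_1,c_1)(g_2,c_2)=(g_1g_2^{c_1},c_1c_2)$; its center is $\{(g,1):g^2=e\}$, of size $2^r$. The commuting graph $\mathfrak{C}(D(G),D(G))$ is the simple graph with vertex set $D(G)$ in which distinct $u,v$ are adjacent iff $uv=vu$. A set $W=\{w_1,\dots,w_k\}$ of vertices of a connected graph is resolving if every vertex $v$ is uniquely determined by the vector $(d(v,w_1),\dots,d(v,w_k))$ of shortest-path distances; the metric dimension $\beta(\Gamma)$ is the minimum size of a resolving set. -}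

module Defs where

open import Data.Nat using (ℕ; zero; suc; _≤_; _^_; _/_)
open import Data.Nat.Properties using (m^n≢0)
open import Data.Fin using (Fin)
open import Data.List using (List; length; filter; allFin)
open import Data.List.Membership.Propositional using (_∈_)
open import Data.List.Relation.Unary.Unique.Propositional using (Unique)
open import Data.Product using (_×_; _,_; ∃)
open import Data.Sign using (Sign; +; -) renaming (_*_ to _*ₛ_)
open import Relation.Binary.PropositionalEquality using (_≡_; _≢_)
open import Relation.Nullary using (¬_)
open import Algebra.Core using (Op₁; Op₂)
open import Algebra.Structures using (IsAbelianGroup)
open import Function.Bundles using (_⇔_)
import Data.Fin.Properties as FinP

data Walk {V : Set} (Adj : V → V → Set) : V → V → ℕ → Set where
  here : ∀ {u} → Walk Adj u u zero
  step : ∀ {u w v k} → Adj u w → Walk Adj w v k → Walk Adj u v (suc k)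

Dist : {V : Set} (Adj : V → V → Set) → V → V → ℕ → Set
Dist Adj u v k = Walk Adj u v k × (∀ m → Walk Adj u v m → k ≤ m)

Resolving : {V : Set} (Adj : V → V → Set) → List V → Set
Resolving Adj W =
  ∀ u v → (∀ w → w ∈ W → ∀ k → Dist Adj u w k ⇔ Dist Adj v w k) → u ≡ v

ResolvingSetOfSize : {V : Set} (Adj : V → V → Set) → ℕ → Set
ResolvingSetOfSize {V} Adj k =
  ∃ λ (W : List V) → Unique W × Resolving Adj W × length W ≡ k

MetricDimension : {V : Set} (Adj : V → V → Set) → ℕ → Set
MetricDimension {V} Adj k =
  ResolvingSetOfSize Adj k ×
  (∀ (W : List V) → Unique W → Resolving Adj W → k ≤ length W)

-- Generalized dihedral group D(G) = G ⋊ C₂ for a group on Fin n,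
-- C₂ = {+1, -1} represented by Sign.

module _ {n : ℕ} (_∙_ : Op₂ (Fin n)) (_⁻¹ : Op₁ (Fin n)) where

  pow : Fin n → Sign → Fin n
  pow g + = g
  pow g - = g ⁻¹

  DG : Set
  DG = Fin n × Sign

  _·D_ : DG → DG → DG
  (g₁ , c₁) ·D (g₂ , c₂) = (g₁ ∙ pow g₂ c₁) , (c₁ *ₛ c₂)

  CommAdj : DG → DG → Set
  CommAdj x y = x ≢ y × (x ·D y) ≡ (y ·D x)

  numInvolutive : Fin n → ℕ
  numInvolutive e = length (filter (λ g → (g ∙ g) FinP.≟ e) (allFin n))

_/2^_ : ℕ → ℕ → ℕ
n /2^ r = _/_ n (2 ^ r) {{m^n≢0 2 r}}

module Submission where

-- Elements of D(G) are rotations (g,⊕) and reflections (g,⊖).  For abelian G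
-- two elements commute exactly when a condition on squares holds
-- (SquareCriterion); in particular (e,⊕) is central, so every distance in the
-- commuting graph is 0, 1 or 2 and is given by an explicit function d
-- (module UniversalVertex).  The dimension then follows from one general
-- principle, UniversalVertex.TwinRetraction: if f retracts the vertices onto a
-- duplicate-free list T of its fixed points, vertices with equal image are
-- twins, and the points moved by f resolve the graph, then the metric dimension
-- is |V| - |T|.  In D(G) (module Dihedral.Retraction) a rotation goes to (e,⊕)
-- or (a,⊕) according to whether it is an involution (a is a fixed
-- non-involution), and a reflection (g,⊖) goes to (ρ g,⊖) for a retraction ρ of
-- G.  With a non-trivial involution, ρ picks a canonical element of equal
-- square and G ≅ representatives × involutions gives |T| = 2 + n/2^r; with e
-- the only involution, squaring is injective, ρ is constant and |T| = 3.

open import Defs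
open import Data.Nat using (ℕ; zero; suc; _≤_; _+_; _*_; _∸_; _^_; z≤n; s≤s; _/_)
open import Data.Nat.Properties
  using (≤-antisym; ≤-trans; +-suc; +-comm; +-monoʳ-≤; *-comm; ∸-+-assoc; m+n∸n≡m; m≤n+o⇒m∸n≤o; m^n≢0;
         module ≤-Reasoning)
open import Data.Nat.DivMod using (m*n/n≡m)
open import Data.Fin using (Fin)
import Data.Fin.Properties as FinP
open import Data.Sign using () renaming (+ to ⊕; - to ⊖)
import Data.Sign.Properties as SignP
open import Data.List using (List; []; _∷_; length; filter; map; _++_; cartesianProduct; allFin)
open import Data.List.Properties using (length-++; length-map; length-tabulate; length-removeAt′)
open import Data.List.Membership.Propositional using (_∈_; _∉_)
open import Data.List.Membership.Propositional.Properties
  using (∈-filter⁺; ∈-filter⁻; ∈-map⁺; ∈-map⁻; ∈-++⁺ˡ; ∈-++⁺ʳ; ∈-allFin;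
         ∈-cartesianProduct⁺; ∈-cartesianProduct⁻)
import Data.List.Membership.DecPropositional as DecMembership
open import Data.List.Relation.Unary.Any using (here; there; index; _─_)
import Data.List.Relation.Unary.All as All
open import Data.List.Relation.Unary.AllPairs using ([]; _∷_)
open import Data.List.Relation.Unary.Unique.Propositional using (Unique)
import Data.List.Relation.Unary.Unique.Propositional.Properties as Unique
open import Data.Product using (_×_; _,_; ∃; proj₁; proj₂)
open import Data.Product.Properties using (≡-dec; ,-injectiveˡ; ,-injectiveʳ)
open import Data.Unit using (⊤; tt)
open import Data.Empty using (⊥-elim)
open import Data.Vec using ([]; _∷_)
open import Relation.Nullary using (¬_; Dec; yes; no; ¬?)
open import Relation.Nullary.Decidable using (_×-dec_; decidable-stable)
open import Relation.Unary using (Decidable)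
open import Relation.Binary.Definitions using (DecidableEquality)
open import Relation.Binary.PropositionalEquality
  using (_≡_; _≢_; refl; sym; trans; cong; cong₂; subst; module ≡-Reasoning)
open import Algebra.Core using (Op₁; Op₂)
open import Algebra.Structures using (IsAbelianGroup)
open import Algebra.Bundles using (AbelianGroup)
import Algebra.Properties.Group as GroupProperties
import Algebra.Properties.AbelianGroup as AbelianGroupProperties
open import Function.Bundles using (mk⇔; Equivalence)
open import Level using (0ℓ)

module Counting where

  ∈-─ : {A : Set} {x w : A} {ys : List A} (x∈ys : x ∈ ys) → w ∈ ys → w ≢ x → w ∈ (ys ─ x∈ys)
  ∈-─ (here refl) (here refl) w≢x = ⊥-elim (w≢x refl)
  ∈-─ (here _)    (there w∈)  _   = w∈
  ∈-─ (there _)   (here refl) _   = here refl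
  ∈-─ (there x∈)  (there w∈)  w≢x = there (∈-─ x∈ w∈ w≢x)

  injection-length : {A B : Set} (f : A → B) {xs : List A} {ys : List B} → Unique xs →
                     (∀ {x} → x ∈ xs → f x ∈ ys) →
                     (∀ {x y} → x ∈ xs → y ∈ xs → f x ≡ f y → x ≡ y) →
                     length xs ≤ length ys
  injection-length f {[]} _ _ _ = z≤n
  injection-length f {x ∷ xs} {ys} (x∉xs ∷ xs-unique) maps injective =
    subst (suc (length xs) ≤_) (sym (length-removeAt′ ys (index fx∈ys))) (s≤s rest)
    where
      fx∈ys : f x ∈ ys
      fx∈ys = maps (here refl)
      rest : length xs ≤ length (ys ─ fx∈ys)
      rest = injection-length f xs-unique
        (λ y∈xs → ∈-─ fx∈ys (maps (there y∈xs))
                    (λ fy≡fx → All.lookup x∉xs y∈xs (injective (here refl) (there y∈xs) (sym fy≡fx))))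
        (λ x∈xs y∈xs → injective (there x∈xs) (there y∈xs))

  ⊆-length : {A : Set} {xs ys : List A} → Unique xs → (∀ {x} → x ∈ xs → x ∈ ys) → length xs ≤ length ys
  ⊆-length xs-unique sub = injection-length (λ x → x) xs-unique sub (λ _ _ eq → eq)

  filter-length : {A : Set} {P : A → Set} (P? : Decidable P) (xs : List A) →
                  length (filter P? xs) + length (filter (λ x → ¬? (P? x)) xs) ≡ length xs
  filter-length P? [] = refl
  filter-length P? (x ∷ xs) with P? x
  ... | yes _ = cong suc (filter-length P? xs)
  ... | no _  = trans (+-suc _ _) (cong suc (filter-length P? xs))

  length-cartesianProduct : {A B : Set} (xs : List A) (ys : List B) →
                            length (cartesianProduct xs ys) ≡ length xs * length ys
  length-cartesianProduct [] ys = refl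
  length-cartesianProduct (x ∷ xs) ys =
    trans (length-++ (map (x ,_) ys))
          (cong₂ _+_ (length-map (x ,_) ys) (length-cartesianProduct xs ys))

open Counting

module UniversalVertex {V : Set} (_≟_ : DecidableEquality V)
                       (R : V → V → Set) (R? : ∀ u v → Dec (R u v))
                       (z : V) (R-to-z : ∀ u → R u z) (R-from-z : ∀ w → R z w) where

  Adj : V → V → Set
  Adj u v = u ≢ v × R u v

  d : V → V → ℕ
  d u w with u ≟ w | R? u w
  ... | yes _ | _     = 0
  ... | no _  | yes _ = 1
  ... | no _  | no _  = 2

  walk-zero : ∀ {u w} → Walk Adj u w 0 → u ≡ w
  walk-zero here = refl

  walk-one : ∀ {u w} → Walk Adj u w 1 → Adj u w
  walk-one (step adj here) = adj

  d-is-distance : ∀ u w → Dist Adj u w (d u w)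
  d-is-distance u w with u ≟ w | R? u w
  ... | yes refl | _ = here , λ _ _ → z≤n
  ... | no u≢w | yes r = step (u≢w , r) here , at-least-one
    where
      at-least-one : ∀ m → Walk Adj u w m → 1 ≤ m
      at-least-one zero    walk = ⊥-elim (u≢w (walk-zero walk))
      at-least-one (suc m) _    = s≤s z≤n
  ... | no u≢w | no ¬r = step (u≢z , R-to-z u) (step (z≢w , R-from-z w) here) , at-least-two
    where
      u≢z : u ≢ z
      u≢z refl = ¬r (R-from-z w)
      z≢w : z ≢ w
      z≢w refl = ¬r (R-to-z u)
      at-least-two : ∀ m → Walk Adj u w m → 2 ≤ m
      at-least-two zero          walk = ⊥-elim (u≢w (walk-zero walk))
      at-least-two (suc zero)    walk = ⊥-elim (¬r (proj₂ (walk-one walk)))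
      at-least-two (suc (suc m)) _    = s≤s (s≤s z≤n)

  distance-is-d : ∀ {u w k} → Dist Adj u w k → k ≡ d u w
  distance-is-d {u} {w} (walk , shortest) =
    ≤-antisym (shortest _ (proj₁ (d-is-distance u w))) (proj₂ (d-is-distance u w) _ walk)

  Separates : List V → Set
  Separates W = ∀ u v → (∀ w → w ∈ W → d u w ≡ d v w) → u ≡ v

  separates⇒resolving : ∀ W → Separates W → Resolving Adj W
  separates⇒resolving W separates u v same = separates u v λ w w∈W →
    distance-is-d (Equivalence.to (same w w∈W (d u w)) (d-is-distance u w))

  resolving⇒separates : ∀ W → Resolving Adj W → Separates W
  resolving⇒separates W resolving u v same = resolving u v λ w w∈W k → mk⇔
    (λ dist → subst (Dist Adj v w) (sym (trans (distance-is-d dist) (same w w∈W))) (d-is-distance v w))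
    (λ dist → subst (Dist Adj u w) (sym (trans (distance-is-d dist) (sym (same w w∈W)))) (d-is-distance u w))

  d-self : ∀ u → d u u ≡ 0
  d-self u with u ≟ u
  ... | yes _   = refl
  ... | no u≢u = ⊥-elim (u≢u refl)

  d-zero : ∀ {u w} → d u w ≡ 0 → u ≡ w
  d-zero {u} {w} _ with u ≟ w | R? u w
  d-zero _  | yes u≡w | _     = u≡w
  d-zero () | no _    | yes _
  d-zero () | no _    | no _

  d-twins : ∀ {u v w} → u ≢ w → v ≢ w → (R u w → R v w) → (R v w → R u w) → d u w ≡ d v w
  d-twins {u} {v} {w} u≢w v≢w uw⇒vw vw⇒uw with u ≟ w | R? u w | v ≟ w | R? v w
  ... | yes u≡w | _     | _       | _      = ⊥-elim (u≢w u≡w)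
  ... | no _    | _     | yes v≡w | _      = ⊥-elim (v≢w v≡w)
  ... | no _    | yes _ | no _    | yes _  = refl
  ... | no _    | yes r | no _    | no ¬r  = ⊥-elim (¬r (uw⇒vw r))
  ... | no _    | no ¬r | no _    | yes r  = ⊥-elim (¬r (vw⇒uw r))
  ... | no _    | no _  | no _    | no _   = refl

  d-separates : ∀ {u v w} → u ≢ w → v ≢ w → R u w → ¬ R v w → d u w ≢ d v w
  d-separates {u} {v} {w} u≢w v≢w r ¬r with u ≟ w | R? u w | v ≟ w | R? v w
  ... | yes u≡w | _      | _       | _      = ⊥-elim (u≢w u≡w)
  ... | no _    | _      | yes v≡w | _      = ⊥-elim (v≢w v≡w)
  ... | no _    | no ¬r′ | no _    | _      = ⊥-elim (¬r′ r)
  ... | no _    | yes _  | no _    | yes r′ = ⊥-elim (¬r r′)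
  ... | no _    | yes _  | no _    | no _   = λ ()

  open DecMembership _≟_ using (_∈?_; _∉?_)

  -- Vertices outside a resolving set
  -- are never twins, so at most |T| of them exist; when the points moved by f
  -- resolve the graph, this bound is attained.
  module TwinRetraction (allV : List V) (allV-unique : Unique allV) (allV-complete : ∀ v → v ∈ allV)
                        (f : V → V) (T : List V) (T-unique : Unique T)
                        (f-into-T : ∀ u → f u ∈ T) (T-fixed : ∀ {v} → v ∈ T → f v ≡ v)
                        (twins : ∀ {u v w} → f u ≡ f v → u ≢ w → v ≢ w → d u w ≡ d v w) where

    lower-bound : ∀ W → Resolving Adj W → length allV ≤ length W + length T
    lower-bound W resolving = begin
      length allV               ≤⟨ ⊆-length allV-unique (λ {x} _ → covered x) ⟩
      length (W ++ outside)     ≡⟨ length-++ W ⟩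
      length W + length outside ≤⟨ +-monoʳ-≤ (length W) outside-fits ⟩
      length W + length T       ∎
      where
        open ≤-Reasoning
        outside : List V
        outside = filter (_∉? W) allV
        covered : ∀ x → x ∈ W ++ outside
        covered x with x ∈? W
        ... | yes x∈W = ∈-++⁺ˡ x∈W
        ... | no x∉W  = ∈-++⁺ʳ W (∈-filter⁺ (_∉? W) (allV-complete x) x∉W)
        not-in-W : ∀ {x} → x ∈ outside → x ∉ W
        not-in-W x∈ = proj₂ (∈-filter⁻ (_∉? W) {xs = allV} x∈)
        -- f is injective on the vertices outside W, since equal images make them twins.
        outside-fits : length outside ≤ length T
        outside-fits = injection-length f (Unique.filter⁺ (_∉? W) allV-unique) (λ {x} _ → f-into-T x)
          λ x∈ y∈ fx≡fy → resolving⇒separates W resolving _ _ λ w w∈W →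
            twins fx≡fy (λ { refl → not-in-W x∈ w∈W }) (λ { refl → not-in-W y∈ w∈W })

    moved : List V
    moved = filter (λ v → ¬? (f v ≟ v)) allV

    fixed : List V
    fixed = filter (λ v → f v ≟ v) allV

    fixed-length : length fixed ≡ length T
    fixed-length = ≤-antisym
      (⊆-length (Unique.filter⁺ _ allV-unique)
        λ {v} v∈ → subst (_∈ T) (proj₂ (∈-filter⁻ (λ v → f v ≟ v) {xs = allV} v∈)) (f-into-T v))
      (⊆-length T-unique λ {v} v∈T → ∈-filter⁺ (λ v → f v ≟ v) (allV-complete v) (T-fixed v∈T))

    moved-length : length moved ≡ length allV ∸ length T
    moved-length = begin
      length moved                                ≡⟨ sym (m+n∸n≡m (length moved) (length fixed)) ⟩
      length moved + length fixed ∸ length fixed  ≡⟨ cong₂ _∸_ partition fixed-length ⟩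
      length allV ∸ length T                      ∎
      where
        open ≡-Reasoning
        partition : length moved + length fixed ≡ length allV
        partition = trans (+-comm (length moved) (length fixed)) (filter-length (λ v → f v ≟ v) allV)

    metric-dimension : (∀ u v → (∀ w → f w ≢ w → d u w ≡ d v w) → u ≡ v) →
                       MetricDimension Adj (length allV ∸ length T)
    metric-dimension moved-separate =
      (moved , Unique.filter⁺ _ allV-unique , moved-resolving , moved-length) ,
      λ W _ resolving → m≤n+o⇒m∸n≤o (length allV) (length T)
        (subst (length allV ≤_) (+-comm (length W) (length T)) (lower-bound W resolving))
      where
        moved-resolving : Resolving Adj moved
        moved-resolving = separates⇒resolving moved λ u v same →
          moved-separate u v λ w fw≢w → same w (∈-filter⁺ (λ v → ¬? (f v ≟ v)) (allV-complete w) fw≢w)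

module Dihedral {n : ℕ} {mul : Op₂ (Fin n)} {e : Fin n} {inv : Op₁ (Fin n)}
                (isAbelianGroup : IsAbelianGroup _≡_ mul e inv) where

  G : AbelianGroup 0ℓ 0ℓ
  G = record { isAbelianGroup = isAbelianGroup }

  open AbelianGroup G using (_∙_; _⁻¹; comm; identityˡ; identityʳ; inverseˡ; inverseʳ; commutativeMonoid)
  open GroupProperties (AbelianGroup.group G)
    using (∙-cancelˡ; ∙-cancelʳ; inverseʳ-unique; x∙y⁻¹≈ε⇒x≈y; ⁻¹-injective; ε⁻¹≈ε)
  open AbelianGroupProperties G using (⁻¹-∙-comm)
  open import Algebra.Solver.CommutativeMonoid commutativeMonoid using (prove; var) renaming (_⊕_ to _⊛_)
  open ≡-Reasoning

  sq : Fin n → Fin n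
  sq g = g ∙ g

  sq-e : sq e ≡ e
  sq-e = identityˡ e

  sq-∙ : ∀ g h → sq (g ∙ h) ≡ sq g ∙ sq h
  sq-∙ g h = prove 2 ((x ⊛ y) ⊛ (x ⊛ y)) ((x ⊛ x) ⊛ (y ⊛ y)) (g ∷ h ∷ [])
    where x = var Fin.zero
          y = var (Fin.suc Fin.zero)

  sq-⁻¹ : ∀ g → sq (g ⁻¹) ≡ sq g ⁻¹
  sq-⁻¹ g = ⁻¹-∙-comm g g

  sq-times-involution : ∀ g {ω} → sq ω ≡ e → sq (g ∙ ω) ≡ sq g
  sq-times-involution g {ω} ω² = trans (sq-∙ g ω) (trans (cong (sq g ∙_) ω²) (identityʳ (sq g)))

  sq-quotient : ∀ {g h} → sq g ≡ sq h → sq (g ∙ h ⁻¹) ≡ e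
  sq-quotient {g} {h} g²≡h² = begin
    sq (g ∙ h ⁻¹)     ≡⟨ sq-∙ g (h ⁻¹) ⟩
    sq g ∙ sq (h ⁻¹)  ≡⟨ cong₂ _∙_ g²≡h² (sq-⁻¹ h) ⟩
    sq h ∙ sq h ⁻¹    ≡⟨ inverseʳ (sq h) ⟩
    e                 ∎

  quotient-times-product : ∀ g h → (g ∙ h ⁻¹) ∙ (g ∙ h) ≡ sq g
  quotient-times-product g h = begin
    (g ∙ h ⁻¹) ∙ (g ∙ h)  ≡⟨ prove 3 ((x ⊛ y) ⊛ (x ⊛ z)) ((x ⊛ x) ⊛ (y ⊛ z)) (g ∷ h ⁻¹ ∷ h ∷ []) ⟩
    sq g ∙ (h ⁻¹ ∙ h)     ≡⟨ cong (sq g ∙_) (inverseˡ h) ⟩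
    sq g ∙ e              ≡⟨ identityʳ (sq g) ⟩
    sq g                  ∎
    where x = var Fin.zero
          y = var (Fin.suc Fin.zero)
          z = var (Fin.suc (Fin.suc Fin.zero))

  conjugation-criterion⇒ : ∀ g h → g ∙ h ≡ h ∙ g ⁻¹ → sq g ≡ e
  conjugation-criterion⇒ g h gh≡hg⁻¹ = trans (cong (g ∙_) g≡g⁻¹) (inverseʳ g)
    where g≡g⁻¹ : g ≡ g ⁻¹
          g≡g⁻¹ = ∙-cancelˡ h g (g ⁻¹) (trans (comm h g) gh≡hg⁻¹)

  conjugation-criterion⇐ : ∀ g h → sq g ≡ e → g ∙ h ≡ h ∙ g ⁻¹
  conjugation-criterion⇐ g h g² = trans (comm g h) (cong (h ∙_) (inverseʳ-unique g g g²))

  -- g h⁻¹ = h g⁻¹ holds exactly when g² = h²; multiply both sides by g h.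
  quotient-criterion⇒ : ∀ g h → g ∙ h ⁻¹ ≡ h ∙ g ⁻¹ → sq g ≡ sq h
  quotient-criterion⇒ g h eq = begin
    sq g                  ≡⟨ sym (quotient-times-product g h) ⟩
    (g ∙ h ⁻¹) ∙ (g ∙ h)  ≡⟨ cong₂ _∙_ eq (comm g h) ⟩
    (h ∙ g ⁻¹) ∙ (h ∙ g)  ≡⟨ quotient-times-product h g ⟩
    sq h                  ∎

  quotient-criterion⇐ : ∀ g h → sq g ≡ sq h → g ∙ h ⁻¹ ≡ h ∙ g ⁻¹
  quotient-criterion⇐ g h g²≡h² = ∙-cancelʳ (g ∙ h) (g ∙ h ⁻¹) (h ∙ g ⁻¹) (begin
    (g ∙ h ⁻¹) ∙ (g ∙ h)  ≡⟨ quotient-times-product g h ⟩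
    sq g                  ≡⟨ g²≡h² ⟩
    sq h                  ≡⟨ sym (quotient-times-product h g) ⟩
    (h ∙ g ⁻¹) ∙ (h ∙ g)  ≡⟨ cong ((h ∙ g ⁻¹) ∙_) (comm h g) ⟩
    (h ∙ g ⁻¹) ∙ (g ∙ h)  ∎)

  V : Set
  V = DG _∙_ _⁻¹

  _≟V_ : DecidableEquality V
  _≟V_ = ≡-dec FinP._≟_ SignP._≟_

  Commute : V → V → Set
  Commute u v = _·D_ _∙_ _⁻¹ u v ≡ _·D_ _∙_ _⁻¹ v u

  commute? : ∀ u v → Dec (Commute u v)
  commute? u v = _·D_ _∙_ _⁻¹ u v ≟V _·D_ _∙_ _⁻¹ v u

  SquareCriterion : V → V → Set
  SquareCriterion (g , ⊕) (h , ⊕) = ⊤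
  SquareCriterion (g , ⊕) (h , ⊖) = sq g ≡ e
  SquareCriterion (g , ⊖) (h , ⊕) = sq h ≡ e
  SquareCriterion (g , ⊖) (h , ⊖) = sq g ≡ sq h

  commute⇒criterion : ∀ u v → Commute u v → SquareCriterion u v
  commute⇒criterion (g , ⊕) (h , ⊕) _ = tt
  commute⇒criterion (g , ⊕) (h , ⊖) c = conjugation-criterion⇒ g h (,-injectiveˡ c)
  commute⇒criterion (g , ⊖) (h , ⊕) c = conjugation-criterion⇒ h g (sym (,-injectiveˡ c))
  commute⇒criterion (g , ⊖) (h , ⊖) c = quotient-criterion⇒ g h (,-injectiveˡ c)

  criterion⇒commute : ∀ u v → SquareCriterion u v → Commute u v
  criterion⇒commute (g , ⊕) (h , ⊕) _  = cong (_, ⊕) (comm g h)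
  criterion⇒commute (g , ⊕) (h , ⊖) g² = cong (_, ⊖) (conjugation-criterion⇐ g h g²)
  criterion⇒commute (g , ⊖) (h , ⊕) h² = cong (_, ⊖) (sym (conjugation-criterion⇐ h g h²))
  criterion⇒commute (g , ⊖) (h , ⊖) eq = cong (_, ⊕) (quotient-criterion⇐ g h eq)

  commute-to-e : ∀ u → Commute u (e , ⊕)
  commute-to-e (g , ⊕) = criterion⇒commute (g , ⊕) (e , ⊕) tt
  commute-to-e (g , ⊖) = criterion⇒commute (g , ⊖) (e , ⊕) sq-e

  commute-from-e : ∀ w → Commute (e , ⊕) w
  commute-from-e (h , ⊕) = criterion⇒commute (e , ⊕) (h , ⊕) tt
  commute-from-e (h , ⊖) = criterion⇒commute (e , ⊕) (h , ⊖) sq-e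

  open UniversalVertex _≟V_ Commute commute? (e , ⊕) commute-to-e commute-from-e public

  allV : List V
  allV = cartesianProduct (allFin n) (⊕ ∷ ⊖ ∷ [])

  allV-unique : Unique allV
  allV-unique = Unique.cartesianProduct⁺ (Unique.allFin⁺ n) (((λ ()) All.∷ All.[]) ∷ All.[] ∷ [])

  allV-complete : ∀ v → v ∈ allV
  allV-complete (g , ⊕) = ∈-cartesianProduct⁺ (∈-allFin g) (here refl)
  allV-complete (g , ⊖) = ∈-cartesianProduct⁺ (∈-allFin g) (there (here refl))

  allV-length : length allV ≡ 2 * n
  allV-length = trans (length-cartesianProduct (allFin n) (⊕ ∷ ⊖ ∷ []))
                      (trans (cong (_* 2) (length-tabulate {n = n} (λ g → g))) (*-comm n 2))

  involutions : List (Fin n)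
  involutions = filter (λ g → sq g FinP.≟ e) (allFin n)

  involutions-unique : Unique involutions
  involutions-unique = Unique.filter⁺ (λ g → sq g FinP.≟ e) (Unique.allFin⁺ n)

  ∈-involutions : ∀ {g} → sq g ≡ e → g ∈ involutions
  ∈-involutions {g} g² = ∈-filter⁺ (λ g → sq g FinP.≟ e) (∈-allFin g) g²

  involutions-sq : ∀ {g} → g ∈ involutions → sq g ≡ e
  involutions-sq g∈ = proj₂ (∈-filter⁻ (λ g → sq g FinP.≟ e) {xs = allFin n} g∈)

  non-involution≢e : ∀ {a} → sq a ≢ e → a ≢ e
  non-involution≢e a²≢e a≡e = a²≢e (trans (cong sq a≡e) sq-e)

  -- If D(G) is not abelian, some element of G is not an involution, since by
  -- SquareCriterion a group of involutions makes D(G) abelian.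
  non-involution : ¬ (∀ u v → Commute u v) → ∃ λ a → sq a ≢ e
  non-involution non-abelian =
    FinP.¬∀⟶∃¬ n (λ a → sq a ≡ e) (λ a → sq a FinP.≟ e) λ all-involutions →
      non-abelian λ u v → criterion⇒commute u v (criterion-holds all-involutions u v)
    where
      criterion-holds : (∀ g → sq g ≡ e) → ∀ u v → SquareCriterion u v
      criterion-holds _   (g , ⊕) (h , ⊕) = tt
      criterion-holds all (g , ⊕) (h , ⊖) = all g
      criterion-holds all (g , ⊖) (h , ⊕) = all h
      criterion-holds all (g , ⊖) (h , ⊖) = trans (all g) (sym (all h))

  2≰1 : ¬ (2 ≤ 1)
  2≰1 (s≤s ())

  nontrivial-involution : 2 ≤ length involutions → ∃ λ ω → sq ω ≡ e × ω ≢ e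
  nontrivial-involution two≤ with FinP.any? (λ ω → (sq ω FinP.≟ e) ×-dec ¬? (ω FinP.≟ e))
  ... | yes (ω , ω² , ω≢e) = ω , ω² , ω≢e
  ... | no none = ⊥-elim (2≰1 (≤-trans two≤ (⊆-length involutions-unique only-e)))
    where
      only-e : ∀ {ω} → ω ∈ involutions → ω ∈ e ∷ []
      only-e {ω} ω∈ with ω FinP.≟ e
      ... | yes ω≡e = here ω≡e
      ... | no ω≢e  = ⊥-elim (none (ω , involutions-sq ω∈ , ω≢e))

  sq-injective : length involutions ≡ 1 → ∀ {g h} → sq g ≡ sq h → g ≡ h
  sq-injective one {g} {h} g²≡h² = x∙y⁻¹≈ε⇒x≈y g h (only-e (sq-quotient g²≡h²))
    where
      only-e : ∀ {ω} → sq ω ≡ e → ω ≡ e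
      only-e {ω} ω² with ω FinP.≟ e
      ... | yes ω≡e = ω≡e
      ... | no ω≢e  = ⊥-elim (2≰1 (subst (2 ≤_) one (⊆-length ((ω≢e All.∷ All.[]) ∷ All.[] ∷ [])
                        λ { (here refl) → ∈-involutions ω² ; (there (here refl)) → ∈-involutions sq-e })))

  root-of : ∀ {s} → Dec (∃ λ g → sq g ≡ s) → Fin n
  root-of (yes (g , _)) = g
  root-of (no _)        = e

  root-of-is-root : ∀ {s} (found : Dec (∃ λ g → sq g ≡ s)) → ∃ (λ g → sq g ≡ s) →
                    sq (root-of found) ≡ s
  root-of-is-root (yes (_ , g²≡s)) _      = g²≡s
  root-of-is-root (no none)        square = ⊥-elim (none square)

  -- A fixed choice of square root, defined from s alone so that it respects squares.
  root : Fin n → Fin n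
  root s = root-of (FinP.any? (λ g → sq g FinP.≟ s))

  canon : Fin n → Fin n
  canon g = root (sq g)

  sq-canon : ∀ g → sq (canon g) ≡ sq g
  sq-canon g = root-of-is-root (FinP.any? (λ h → sq h FinP.≟ sq g)) (g , refl)

  canon-respects-sq : ∀ {g h} → sq g ≡ sq h → canon g ≡ canon h
  canon-respects-sq = cong root

  -- The canonical elements, one for each square in G.
  representatives : List (Fin n)
  representatives = filter (λ g → canon g FinP.≟ g) (allFin n)

  representatives-unique : Unique representatives
  representatives-unique = Unique.filter⁺ (λ g → canon g FinP.≟ g) (Unique.allFin⁺ n)

  canon-∈-representatives : ∀ g → canon g ∈ representatives
  canon-∈-representatives g =
    ∈-filter⁺ (λ g → canon g FinP.≟ g) (∈-allFin (canon g)) (canon-respects-sq (sq-canon g))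

  representatives-canonical : ∀ {c} → c ∈ representatives → canon c ≡ c
  representatives-canonical c∈ = proj₂ (∈-filter⁻ (λ g → canon g FinP.≟ g) {xs = allFin n} c∈)

  -- Every g factors uniquely as g = c ω with c canonical and ω an involution,
  -- namely c = canon g; hence n = (number of squares) · (number of involutions).
  order-factorisation : n ≡ length representatives * length involutions
  order-factorisation = begin
    n                                             ≡⟨ sym (length-tabulate {n = n} (λ g → g)) ⟩
    length (allFin n)                             ≡⟨ ≤-antisym split-injective merge-injective ⟩
    length pairs                                  ≡⟨ length-cartesianProduct representatives involutions ⟩
    length representatives * length involutions   ∎
    where
      pairs : List (Fin n × Fin n)
      pairs = cartesianProduct representatives involutions

      split : Fin n → Fin n × Fin n
      split g = canon g , g ∙ canon g ⁻¹

      split-injective : length (allFin n) ≤ length pairs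
      split-injective = injection-length split (Unique.allFin⁺ n)
        (λ {g} _ → ∈-cartesianProduct⁺ (canon-∈-representatives g) (∈-involutions (sq-quotient (sym (sq-canon g)))))
        λ {g} {h} _ _ eq → ∙-cancelʳ (canon g ⁻¹) g h
          (trans (,-injectiveʳ eq) (cong (λ c → h ∙ c ⁻¹) (sym (,-injectiveˡ eq))))

      merge-injective : length pairs ≤ length (allFin n)
      merge-injective = injection-length (λ { (c , ω) → c ∙ ω })
        (Unique.cartesianProduct⁺ representatives-unique involutions-unique) (λ _ → ∈-allFin _)
        λ { {c , ω} {c′ , ω′} p p′ cω≡c′ω′ →
          let (c∈ , ω∈)   = ∈-cartesianProduct⁻ representatives involutions p
              (c′∈ , ω′∈) = ∈-cartesianProduct⁻ representatives involutions p′
              c²≡c′² : sq c ≡ sq c′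
              c²≡c′² = trans (sym (sq-times-involution c (involutions-sq ω∈)))
                         (trans (cong sq cω≡c′ω′) (sq-times-involution c′ (involutions-sq ω′∈)))
              c≡c′ : c ≡ c′
              c≡c′ = trans (sym (representatives-canonical c∈))
                       (trans (canon-respects-sq c²≡c′²) (representatives-canonical c′∈))
          in cong₂ _,_ c≡c′ (∙-cancelˡ c ω ω′ (trans cω≡c′ω′ (cong (_∙ ω′) (sym c≡c′)))) }

  -- Rotations are retracted onto (e,⊕) or (a,⊕) according to whether they are
  -- involutions, reflections (g,⊖) onto (ρ g,⊖); the moved vertices then form a
  -- minimum resolving set.
  module Retraction (a : Fin n) (a²≢e : sq a ≢ e)
                    (ρ : Fin n → Fin n) (R : List (Fin n)) (R-unique : Unique R)
                    (ρ-into-R : ∀ g → ρ g ∈ R) (R-fixed : ∀ {g} → g ∈ R → ρ g ≡ g)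
                    (ρ-twins : ∀ {g h k} → ρ g ≡ ρ h → g ≢ k → sq g ≡ sq k → sq h ≡ sq k)
                    (ρ-separates : ∀ {g h} → ρ g ≡ g → ρ h ≡ h → g ≢ h →
                                   ∃ λ k → ρ k ≢ k × sq k ≡ sq g × sq k ≢ sq h)
                    (ρ-moves : ∃ λ k → ρ k ≢ k) where

    a≢e : a ≢ e
    a≢e = non-involution≢e a²≢e

    rotation-rep : Fin n → V
    rotation-rep g with sq g FinP.≟ e
    ... | yes _ = e , ⊕
    ... | no _  = a , ⊕

    rotation-rep-involution : ∀ {g} → sq g ≡ e → rotation-rep g ≡ (e , ⊕)
    rotation-rep-involution {g} g² with sq g FinP.≟ e
    ... | yes _  = refl
    ... | no g²≢e = ⊥-elim (g²≢e g²)

    rotation-rep-other : ∀ {g} → sq g ≢ e → rotation-rep g ≡ (a , ⊕)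
    rotation-rep-other {g} g²≢e with sq g FinP.≟ e
    ... | yes g² = ⊥-elim (g²≢e g²)
    ... | no _   = refl

    rotation-rep-reflects : ∀ {g h} → rotation-rep g ≡ rotation-rep h → sq g ≡ e → sq h ≡ e
    rotation-rep-reflects {g} {h} eq g² = decidable-stable (sq h FinP.≟ e) λ h²≢e →
      a≢e (sym (,-injectiveˡ (trans (sym (rotation-rep-involution g²)) (trans eq (rotation-rep-other h²≢e)))))

    rotation-rep≢reflection : ∀ g {h} → rotation-rep g ≢ (h , ⊖)
    rotation-rep≢reflection g with sq g FinP.≟ e
    ... | yes _ = λ ()
    ... | no _  = λ ()

    rep : V → V
    rep (g , ⊕) = rotation-rep g
    rep (g , ⊖) = ρ g , ⊖

    T : List V
    T = (e , ⊕) ∷ (a , ⊕) ∷ map (_, ⊖) R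

    rep-into-T : ∀ u → rep u ∈ T
    rep-into-T (g , ⊕) with sq g FinP.≟ e
    ... | yes _ = here refl
    ... | no _  = there (here refl)
    rep-into-T (g , ⊖) = there (there (∈-map⁺ (_, ⊖) (ρ-into-R g)))

    T-fixed : ∀ {v} → v ∈ T → rep v ≡ v
    T-fixed (here refl)         = rotation-rep-involution sq-e
    T-fixed (there (here refl)) = rotation-rep-other a²≢e
    T-fixed (there (there v∈)) with ∈-map⁻ (_, ⊖) v∈
    ... | g , g∈R , refl = cong (_, ⊖) (R-fixed g∈R)

    T-unique : Unique T
    T-unique = ((λ eq → a≢e (sym (,-injectiveˡ eq))) All.∷ rotations≢reflections e R)
             ∷ rotations≢reflections a R
             ∷ Unique.map⁺ (,-injectiveˡ) R-unique
      where
        rotations≢reflections : ∀ g gs → All.All ((g , ⊕) ≢_) (map (_, ⊖) gs)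
        rotations≢reflections g []       = All.[]
        rotations≢reflections g (_ ∷ gs) = (λ ()) All.∷ rotations≢reflections g gs

    same-rep-criterion : ∀ {u v w} → rep u ≡ rep v → u ≢ w → SquareCriterion u w → SquareCriterion v w
    same-rep-criterion {g , ⊕} {h , ⊕} {k , ⊕} _  _   _  = tt
    same-rep-criterion {g , ⊕} {h , ⊕} {k , ⊖} eq _   g² = rotation-rep-reflects eq g²
    same-rep-criterion {g , ⊕} {h , ⊖}         eq _   _  = ⊥-elim (rotation-rep≢reflection g eq)
    same-rep-criterion {g , ⊖} {h , ⊕}         eq _   _  = ⊥-elim (rotation-rep≢reflection h (sym eq))
    same-rep-criterion {g , ⊖} {h , ⊖} {k , ⊕} _  _   k² = k²
    same-rep-criterion {g , ⊖} {h , ⊖} {k , ⊖} eq u≢w g²≡k² =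
      ρ-twins (,-injectiveˡ eq) (λ g≡k → u≢w (cong (_, ⊖) g≡k)) g²≡k²

    rep-twins : ∀ {u v w} → rep u ≡ rep v → u ≢ w → v ≢ w → d u w ≡ d v w
    rep-twins {u} {v} {w} eq u≢w v≢w = d-twins u≢w v≢w
      (λ c → criterion⇒commute v w (same-rep-criterion eq u≢w (commute⇒criterion u w c)))
      (λ c → criterion⇒commute u w (same-rep-criterion (sym eq) v≢w (commute⇒criterion v w c)))

    Agree : V → V → Set
    Agree u v = ∀ w → rep w ≢ w → d u w ≡ d v w

    agree-sym : ∀ {u v} → Agree u v → Agree v u
    agree-sym agree w moved = sym (agree w moved)

    told-apart : ∀ {u v} w → rep u ≡ u → rep v ≡ v → rep w ≢ w →
                 SquareCriterion u w → ¬ SquareCriterion v w → ¬ Agree u v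
    told-apart {u} {v} w fixed-u fixed-v moved-w c ¬c agree =
      d-separates (fixed≢moved fixed-u) (fixed≢moved fixed-v)
        (criterion⇒commute u w c) (λ c′ → ¬c (commute⇒criterion v w c′)) (agree w moved-w)
      where fixed≢moved : ∀ {x} → rep x ≡ x → x ≢ w
            fixed≢moved fixed refl = moved-w fixed

    k₀ : Fin n
    k₀ = proj₁ ρ-moves

    moved-reflection : rep (k₀ , ⊖) ≢ (k₀ , ⊖)
    moved-reflection fixed = proj₂ ρ-moves (,-injectiveˡ fixed)

    a⁻¹²≢e : sq (a ⁻¹) ≢ e
    a⁻¹²≢e a⁻¹²≡e = a²≢e (⁻¹-injective (trans (sym (sq-⁻¹ a)) (trans a⁻¹²≡e (sym ε⁻¹≈ε))))

    moved-rotation : rep (a ⁻¹ , ⊕) ≢ (a ⁻¹ , ⊕)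
    moved-rotation fixed = a²≢e (trans (cong (a ∙_) a≡a⁻¹) (inverseʳ a))
      where a≡a⁻¹ : a ≡ a ⁻¹
            a≡a⁻¹ = ,-injectiveˡ (trans (sym (rotation-rep-other a⁻¹²≢e)) fixed)

    -- The two rotation representatives are told apart by a moved reflection,
    -- a rotation and a reflection by the moved rotation (a⁻¹,⊕), and two
    -- reflection representatives by the hypothesis ρ-separates.
    fixed-separate : ∀ u v → rep u ≡ u → rep v ≡ v → Agree u v → u ≡ v
    fixed-separate (g , ⊕) (h , ⊕) = rotations-separate (sq g FinP.≟ e) (sq h FinP.≟ e)
      where
        rotations-separate : Dec (sq g ≡ e) → Dec (sq h ≡ e) →
                             rep (g , ⊕) ≡ (g , ⊕) → rep (h , ⊕) ≡ (h , ⊕) →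
                             Agree (g , ⊕) (h , ⊕) → (g , ⊕) ≡ (h , ⊕)
        rotations-separate (yes g²) (yes h²) fixed-u fixed-v _ =
          trans (sym fixed-u) (trans (trans (rotation-rep-involution g²) (sym (rotation-rep-involution h²))) fixed-v)
        rotations-separate (no g²≢e) (no h²≢e) fixed-u fixed-v _ =
          trans (sym fixed-u) (trans (trans (rotation-rep-other g²≢e) (sym (rotation-rep-other h²≢e))) fixed-v)
        rotations-separate (yes g²) (no h²≢e) fixed-u fixed-v agree =
          ⊥-elim (told-apart (k₀ , ⊖) fixed-u fixed-v moved-reflection g² h²≢e agree)
        rotations-separate (no g²≢e) (yes h²) fixed-u fixed-v agree =
          ⊥-elim (told-apart (k₀ , ⊖) fixed-v fixed-u moved-reflection h² g²≢e (agree-sym agree))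
    fixed-separate (g , ⊕) (h , ⊖) fixed-u fixed-v agree =
      ⊥-elim (told-apart (a ⁻¹ , ⊕) fixed-u fixed-v moved-rotation tt a⁻¹²≢e agree)
    fixed-separate (g , ⊖) (h , ⊕) fixed-u fixed-v agree =
      ⊥-elim (told-apart (a ⁻¹ , ⊕) fixed-v fixed-u moved-rotation tt a⁻¹²≢e (agree-sym agree))
    fixed-separate (g , ⊖) (h , ⊖) fixed-u fixed-v agree with g FinP.≟ h
    ... | yes g≡h = cong (_, ⊖) g≡h
    ... | no g≢h with ρ-separates (,-injectiveˡ fixed-u) (,-injectiveˡ fixed-v) g≢h
    ...   | k , ρk≢k , k²≡g² , k²≢h² =
      ⊥-elim (told-apart (k , ⊖) fixed-u fixed-v (λ fixed → ρk≢k (,-injectiveˡ fixed))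
                (sym k²≡g²) (λ h²≡k² → k²≢h² (sym h²≡k²)) agree)

    metric-dimension : MetricDimension Adj (2 * n ∸ (2 + length R))
    metric-dimension = subst (MetricDimension Adj) size
      (TwinRetraction.metric-dimension allV allV-unique allV-complete rep T T-unique rep-into-T T-fixed rep-twins
        moved-separate)
      where
        size : length allV ∸ length T ≡ 2 * n ∸ (2 + length R)
        size = cong₂ _∸_ allV-length (cong (2 +_) (length-map (_, ⊖) R))
        -- A moved vertex is told apart from every vertex by its zero distance to itself.
        moved-separate : ∀ u v → Agree u v → u ≡ v
        moved-separate u v agree with rep u ≟V u | rep v ≟V v
        ... | no moved-u | _          = sym (d-zero (trans (sym (agree u moved-u)) (d-self u)))
        ... | yes _      | no moved-v = d-zero (trans (agree v moved-v) (d-self v))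
        ... | yes fixed-u | yes fixed-v = fixed-separate u v fixed-u fixed-v agree

  -- If e is the only involution, squaring is injective, so distinct
  -- reflections never commute and all reflections are twins: take ρ = const e.
  dimension-one-involution : ∃ (λ a → sq a ≢ e) → length involutions ≡ 1 → MetricDimension Adj (2 * n ∸ 3)
  dimension-one-involution (a , a²≢e) one =
    Retraction.metric-dimension a a²≢e (λ _ → e) (e ∷ []) (All.[] ∷ []) (λ _ → here refl)
      (λ { (here refl) → refl }) twins separates (a , λ e≡a → non-involution≢e a²≢e (sym e≡a))
    where
      twins : ∀ {g h k} → e ≡ e → g ≢ k → sq g ≡ sq k → sq h ≡ sq k
      twins _ g≢k g²≡k² = ⊥-elim (g≢k (sq-injective one g²≡k²))
      separates : ∀ {g h} → e ≡ g → e ≡ h → g ≢ h → ∃ λ k → e ≢ k × sq k ≡ sq g × sq k ≢ sq h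
      separates refl refl g≢h = ⊥-elim (g≢h refl)

  -- If there is an involution ω ≠ e, take ρ = canon.  Distinct representatives
  -- g, h have distinct squares, and g ω is moved by canon but has the square of g.
  dimension-many-involutions : ∃ (λ a → sq a ≢ e) → 2 ≤ length involutions →
                               MetricDimension Adj (2 * n ∸ (2 + length representatives))
  dimension-many-involutions (a , a²≢e) two≤ with nontrivial-involution two≤
  ... | ω , ω² , ω≢e =
    Retraction.metric-dimension a a²≢e canon representatives representatives-unique
      canon-∈-representatives representatives-canonical twins separates moves
    where
      twins : ∀ {g h k} → canon g ≡ canon h → g ≢ k → sq g ≡ sq k → sq h ≡ sq k
      twins {g} {h} canon-g≡canon-h _ g²≡k² =
        trans (sym (sq-canon h)) (trans (cong sq (sym canon-g≡canon-h)) (trans (sq-canon g) g²≡k²))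

      separates : ∀ {g h} → canon g ≡ g → canon h ≡ h → g ≢ h →
                  ∃ λ k → canon k ≢ k × sq k ≡ sq g × sq k ≢ sq h
      separates {g} {h} canonical-g canonical-h g≢h =
        g ∙ ω , gω-moved , sq-times-involution g ω² , λ gω²≡h² →
          g≢h (trans (sym canonical-g)
                (trans (canon-respects-sq (trans (sym (sq-times-involution g ω²)) gω²≡h²)) canonical-h))
        where
          gω-moved : canon (g ∙ ω) ≢ g ∙ ω
          gω-moved canonical-gω = ω≢e (∙-cancelˡ g ω e (begin
            g ∙ ω          ≡⟨ sym canonical-gω ⟩
            canon (g ∙ ω)  ≡⟨ canon-respects-sq (sq-times-involution g ω²) ⟩
            canon g        ≡⟨ canonical-g ⟩
            g              ≡⟨ sym (identityʳ g) ⟩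
            g ∙ e          ∎))

      -- Since canon e = canon ω, one of e, ω is moved by canon.
      moves : ∃ λ k → canon k ≢ k
      moves with canon e FinP.≟ e
      ... | no canon-e≢e = e , canon-e≢e
      ... | yes canon-e≡e = ω , λ canonical-ω →
        ω≢e (trans (sym canonical-ω) (trans (canon-respects-sq (trans ω² (sym sq-e))) canon-e≡e))

dimension-formula : ∀ n I r → n ≡ I * 2 ^ r → 2 * n ∸ n /2^ r ∸ 2 ≡ 2 * n ∸ (2 + I)
dimension-formula n I r n≡I2^r = begin
  2 * n ∸ n /2^ r ∸ 2    ≡⟨ ∸-+-assoc (2 * n) (n /2^ r) 2 ⟩
  2 * n ∸ (n /2^ r + 2)  ≡⟨ cong (λ q → 2 * n ∸ (q + 2)) n/2^r≡I ⟩
  2 * n ∸ (I + 2)        ≡⟨ cong (2 * n ∸_) (+-comm I 2) ⟩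
  2 * n ∸ (2 + I)        ∎
  where
    open ≡-Reasoning
    n/2^r≡I : n /2^ r ≡ I
    n/2^r≡I = trans (cong (λ m → _/_ m (2 ^ r) {{m^n≢0 2 r}}) n≡I2^r) (m*n/n≡m I (2 ^ r) {{m^n≢0 2 r}})

theorem4p2 : (n : ℕ) (_∙_ : Op₂ (Fin n)) (e : Fin n) (_⁻¹ : Op₁ (Fin n)) →
    IsAbelianGroup _≡_ _∙_ e _⁻¹ →
    ¬ (∀ x y → _·D_ _∙_ _⁻¹ x y ≡ _·D_ _∙_ _⁻¹ y x) →
    (r : ℕ) → 2 ^ r ≡ numInvolutive _∙_ _⁻¹ e →
    (2 ≤ 2 ^ r → MetricDimension (CommAdj _∙_ _⁻¹) (2 * n ∸ n /2^ r ∸ 2))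
    × (2 ^ r ≡ 1 → MetricDimension (CommAdj _∙_ _⁻¹) (2 * n ∸ 3))
theorem4p2 n _∙_ e _⁻¹ isAbelianGroup non-abelian r 2^r≡|Ω| = many-involutions , one-involution
  where
    open Dihedral isAbelianGroup
      using (Adj; involutions; representatives; non-involution; order-factorisation;
             dimension-many-involutions; dimension-one-involution)

    a : ∃ λ a → a ∙ a ≢ e
    a = non-involution non-abelian

    many-involutions : 2 ≤ 2 ^ r → MetricDimension (CommAdj _∙_ _⁻¹) (2 * n ∸ n /2^ r ∸ 2)
    many-involutions 2≤2^r =
      subst (MetricDimension Adj) (sym (dimension-formula n (length representatives) r n≡I·2^r))
        (dimension-many-involutions a (subst (2 ≤_) 2^r≡|Ω| 2≤2^r))
      where
        n≡I·2^r : n ≡ length representatives * 2 ^ r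
        n≡I·2^r = trans order-factorisation (cong (length representatives *_) (sym 2^r≡|Ω|))

    one-involution : 2 ^ r ≡ 1 → MetricDimension (CommAdj _∙_ _⁻¹) (2 * n ∸ 3)
    one-involution 2^r≡1 = dimension-one-involution a (trans (sym 2^r≡|Ω|) 2^r≡1)
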